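{- Let $n, m$ be positive integers. If the player can win the rotating-table game with parameters $(n,m)$, then $n = 1$, or $m = 1$, or $(n, m) = (p^a, p^b)$ for some prime $p$ and positive integers $a, b$.
   Context: The rotating-table game with parameters $(n,m)$: $n$ counters lie on the vertices (positions $1,\dots,n$, fixed from the player's perspective) of a regular $n$-gon table, each showing an element of $\mathbb{Z}_m$; the initial configuration in $\mathbb{Z}_m^n$ is arbitrary and unknown to the blindfolded player, who receives no information. Each turn the player makes a move $y \in \mathbb{Z}_m^n$, adding $y_i$ to the counter at position $i$; then the table is rotated by an arbitrary (adversarially chosen) rotation, i.e. the counters are cyclically shifted by any amount (possibly zero). A strategy is a fixed finite sequence of moves. The player "can win" if some finite sequence of moves guarantees that, for every initial configuration and every choice of rotations, at some point (initially or after some move) all counters simultaneously show $0$. -}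

module Defs where

open import Data.Nat using (ℕ; zero; suc; _+_; NonZero)
open import Data.Nat.DivMod using (_mod_)
open import Data.Fin using (Fin; toℕ)
open import Data.List using (List; []; _∷_)
open import Data.List.Relation.Unary.Any using (Any)
open import Data.Product using (Σ)
open import Relation.Binary.PropositionalEquality using (_≡_)

Zmod : ℕ → Set
Zmod m = Fin m

addZ : (m : ℕ) .⦃ _ : NonZero m ⦄ → Zmod m → Zmod m → Zmod m
addZ m a b = (toℕ a + toℕ b) mod m

zeroZ : (m : ℕ) .⦃ _ : NonZero m ⦄ → Zmod m
zeroZ m = 0 mod m

-- A configuration (and likewise a move) : positions 1..n (here Fin n) → ℤ_m.
Config : ℕ → ℕ → Set
Config n m = Fin n → Zmod m

applyMove : (n m : ℕ) .⦃ _ : NonZero m ⦄ → Config n m → Config n m → Config n m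
applyMove n m c y i = addZ m (c i) (y i)

-- Rotate the table by k: the new counter at position j is the old counter at
-- position j + k (mod n).  As k ranges over ℕ this gives every rotation
-- (including the identity, k = 0).
rotate : (n m : ℕ) .⦃ _ : NonZero n ⦄ → ℕ → Config n m → Config n m
rotate n m k c j = c ((toℕ j + k) mod n)

AllZero : (n m : ℕ) .⦃ _ : NonZero m ⦄ → Config n m → Set
AllZero n m c = ∀ i → c i ≡ zeroZ m

-- The list of configurations seen during play: the initial configuration,
-- then the configuration after each move (move, then rotation).
-- rs j is the rotation chosen by the adversary after the (j+1)-th move.
states : (n m : ℕ) .⦃ _ : NonZero n ⦄ .⦃ _ : NonZero m ⦄ →
         Config n m → List (Config n m) → (ℕ → ℕ) → List (Config n m)
states n m c []       rs = c ∷ []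
states n m c (y ∷ ys) rs =
  c ∷ states n m (rotate n m (rs 0) (applyMove n m c y)) ys (λ j → rs (suc j))

CanWin : (n m : ℕ) .⦃ _ : NonZero n ⦄ .⦃ _ : NonZero m ⦄ → Set
CanWin n m = Σ (List (Config n m)) λ ys →
  (c : Config n m) (rs : ℕ → ℕ) → Any (AllZero n m) (states n m c ys rs)

-- Suppose n = N p with p > 1 and some prime q divides m but not p.  For a
-- configuration c and 0 ≤ r, let E c r be the sum of the counters at the
-- positions r, r + p, …, r + (N − 1) p, read as integers modulo q, and call c
-- balanced if E c r is the same for all r ≤ p.  Configurations with all
-- counters 0 are balanced, the one with a single counter 1 is not.  If s is
-- unbalanced, then for every move y one of the two configurations that y
-- followed by a rotation by 0 or by 1 turns into s is unbalanced as well: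
-- otherwise E s would grow by the same d at each step r ↦ r + 1, and since
-- E s p = E s 0 this gives p d ≡ 0, hence d ≡ 0 (mod q).  So, walking backwards
-- through any finite sequence of moves, the adversary finds an initial
-- configuration and rotations that never show all zeros.  Such n = N p and q
-- exist unless n = 1, m = 1, or n and m are powers of the same prime.

module Submission where

open import Defs
import Data.Integer.Properties as ℤ
open import Algebra.Properties.AbelianGroup ℤ.+-0-abelianGroup using (∙-cancelˡ)
open import Algebra.Properties.CommutativeMonoid.Sum ℤ.+-0-commutativeMonoid
  using (sum; sum-syntax; sum-cong-≗; sum-remove; sum-init-last; ∑-distrib-+; sum-replicate-zero)
open import Data.Fin as Fin using (Fin; toℕ; inject₁; fromℕ; zero; suc)
import Data.Fin.Properties as Fin
open import Data.Integer using (ℤ; +_; _+_; _-_; _*_; -_; ∣_∣)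
open import Data.Integer.Divisibility.Signed
  using (_∣_; _∣?_; divides; ∣m∣n⇒∣m+n; ∣m⇒∣-m; ∣n⇒∣m*n; ∣⇒∣ᵤ; ∣ᵤ⇒∣)
open import Data.Integer.Tactic.RingSolver using (solve-∀)
open import Data.List using ([]; _∷_)
open import Data.List.Relation.Unary.All as All using (All; []; _∷_)
open import Data.List.Relation.Unary.All.Properties using (All¬⇒¬Any)
open import Data.Nat as ℕ
  using (ℕ; zero; suc; 2+; _≤_; _<_; _≥_; _^_; z≤n; s≤s; z<s; NonZero; _%_; _/_; _∸_)
import Data.Nat.Properties as ℕ
import Data.Nat.Divisibility as ℕ
open import Data.Nat.DivMod
  using (_mod_; m<n⇒m%n≡m; m%n%n≡m%n; %-distribˡ-+; [m+n]%n≡m%n; m≡m%n+[m/n]*n; n%n≡0; m*n%n≡0)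
open import Data.Nat.Induction using (<-wellFounded)
open import Data.Nat.ListAction using (product)
open import Data.Nat.Primality using (Prime; euclidsLemma; prime⇒nonTrivial; prime⇒irreducible)
open import Data.Nat.Primality.Factorisation using (factorise)
open import Data.Product using (Σ; ∃-syntax; ∃₂; _×_; _,_)
open import Data.Sum using (_⊎_; inj₁; inj₂)
open import Data.Vec.Functional using (Vector; removeAt; replicate)
open import Function using (_∘_)
open import Induction.WellFounded using (Acc; acc)
open import Relation.Binary.Bundles using (Setoid)
open import Relation.Binary.Structures using (IsEquivalence)
open import Relation.Binary.PropositionalEquality
open import Relation.Nullary using (Dec; yes; no; ¬_; contradiction)
import Relation.Nullary.Decidable as Dec

prime⇒1< : ∀ {p} → Prime p → 1 < p
prime⇒1< {p} p-prime = ℕ.nonTrivial⇒n>1 p ⦃ prime⇒nonTrivial p-prime ⦄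

prime⇒≢1 : ∀ {p} → Prime p → p ≢ 1
prime⇒≢1 p-prime = ℕ.nonTrivial⇒≢1 ⦃ prime⇒nonTrivial p-prime ⦄

module Congruence (q : ℕ) where

  infix 4 _≈_

  record _≈_ (x y : ℤ) : Set where
    constructor q∣-
    field q∣x-y : + q ∣ x - y

  open _≈_ public

  private
    ∣-resp-≡ : ∀ {x y} → x ≡ y → + q ∣ x → + q ∣ y
    ∣-resp-≡ refl q∣x = q∣x

  ≈-reflexive : ∀ {x y} → x ≡ y → x ≈ y
  ≈-reflexive {x} refl = q∣- (∣-resp-≡ (x-x≡0 x) (divides (+ 0) refl))
    where
    x-x≡0 : ∀ x → + 0 ≡ x - x
    x-x≡0 = solve-∀

  ≈-refl : ∀ {x} → x ≈ x
  ≈-refl = ≈-reflexive refl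

  ≈-sym : ∀ {x y} → x ≈ y → y ≈ x
  ≈-sym {x} {y} (q∣- q∣x-y) = q∣- (∣-resp-≡ (neg x y) (∣m⇒∣-m q∣x-y))
    where
    neg : ∀ x y → - (x - y) ≡ y - x
    neg = solve-∀

  ≈-trans : ∀ {x y z} → x ≈ y → y ≈ z → x ≈ z
  ≈-trans {x} {y} {z} (q∣- q∣x-y) (q∣- q∣y-z) =
    q∣- (∣-resp-≡ (telescope x y z) (∣m∣n⇒∣m+n q∣x-y q∣y-z))
    where
    telescope : ∀ x y z → (x - y) + (y - z) ≡ x - z
    telescope = solve-∀

  ≈-isEquivalence : IsEquivalence _≈_
  ≈-isEquivalence = record { refl = ≈-refl ; sym = ≈-sym ; trans = ≈-trans }

  ≈-setoid : Setoid _ _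
  ≈-setoid = record { isEquivalence = ≈-isEquivalence }

  _≈?_ : ∀ x y → Dec (x ≈ y)
  x ≈? y = Dec.map′ q∣- q∣x-y (+ q ∣? x - y)

  +-cong : ∀ {x x′ y y′} → x ≈ x′ → y ≈ y′ → x + y ≈ x′ + y′
  +-cong {x} {x′} {y} {y′} (q∣- q∣x-x′) (q∣- q∣y-y′) =
    q∣- (∣-resp-≡ (regroup x x′ y y′) (∣m∣n⇒∣m+n q∣x-x′ q∣y-y′))
    where
    regroup : ∀ x x′ y y′ → (x - x′) + (y - y′) ≡ (x + y) - (x′ + y′)
    regroup = solve-∀

  ∣⇒+≈ : ∀ x {y} → + q ∣ y → x + y ≈ x
  ∣⇒+≈ x {y} q∣y = q∣- (∣-resp-≡ (cancel x y) q∣y)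
    where
    cancel : ∀ x y → y ≡ (x + y) - x
    cancel = solve-∀

  +≈⇒∣ : ∀ x {y} → x + y ≈ x → + q ∣ y
  +≈⇒∣ x {y} (q∣- q∣x+y-x) = ∣-resp-≡ (cancel x y) q∣x+y-x
    where
    cancel : ∀ x y → (x + y) - x ≡ y
    cancel = solve-∀

  ∑-cong-≈ : ∀ {K} {f g : Vector ℤ K} → (∀ i → f i ≈ g i) → sum f ≈ sum g
  ∑-cong-≈ {zero}  f≈g = ≈-refl
  ∑-cong-≈ {suc K} f≈g = +-cong (f≈g zero) (∑-cong-≈ (λ i → f≈g (suc i)))

  prime∤p∧∣p*d⇒∣d : ∀ {p d} → Prime q → ¬ q ℕ.∣ p → + q ∣ + p * d → + q ∣ d
  prime∤p∧∣p*d⇒∣d {p} {d} q-prime q∤p q∣p*d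
    with euclidsLemma p ∣ d ∣ q-prime (subst (q ℕ.∣_) (ℤ.abs-* (+ p) d) (∣⇒∣ᵤ q∣p*d))
  ... | inj₁ q∣p = contradiction q∣p q∤p
  ... | inj₂ q∣d = ∣ᵤ⇒∣ q∣d

  module _ {p} (H : ℕ → ℤ) (d : ℤ) (step : ∀ r → r < p → H (suc r) ≈ H r + d) where

    open import Relation.Binary.Reasoning.Setoid ≈-setoid

    progression : ∀ r → r ≤ p → H r ≈ H 0 + + r * d
    progression zero _ = ≈-reflexive (zero-term (H 0) d)
      where
      zero-term : ∀ h d → h ≡ h + + 0 * d
      zero-term = solve-∀
    progression (suc r) r<p = begin
      H (suc r)             ≈⟨ step r r<p ⟩
      H r + d               ≈⟨ +-cong (progression r (ℕ.<⇒≤ r<p)) ≈-refl ⟩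
      H 0 + + r * d + d     ≡⟨ next-term (H 0) (+ r) d ⟩
      H 0 + (+ 1 + + r) * d ≡⟨ cong (λ s → H 0 + s * d) (ℤ.pos-+ 1 r) ⟨
      H 0 + + suc r * d     ∎
      where
      next-term : ∀ h r d → h + r * d + d ≡ h + (+ 1 + r) * d
      next-term = solve-∀

    periodic-progression⇒constant : Prime q → ¬ q ℕ.∣ p → H p ≡ H 0 → ∀ r → r ≤ p → H r ≈ H 0
    periodic-progression⇒constant q-prime q∤p Hp≡H0 r r≤p = begin
      H r            ≈⟨ progression r r≤p ⟩
      H 0 + + r * d  ≈⟨ ∣⇒+≈ (H 0) (∣n⇒∣m*n (+ r) q∣d) ⟩
      H 0            ∎
      where
      q∣d : + q ∣ d
      q∣d = prime∤p∧∣p*d⇒∣d q-prime q∤p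
              (+≈⇒∣ (H 0) (≈-trans (≈-sym (progression p ℕ.≤-refl)) (≈-reflexive Hp≡H0)))

∑-shift : ∀ {K} (g : ℕ → ℤ) → g K ≡ g 0 → ∑[ t < K ] g (suc (toℕ t)) ≡ ∑[ t < K ] g (toℕ t)
∑-shift {K} g gK≡g0 = ∙-cancelˡ (g 0) _ _ (begin
  g 0 + ∑[ t < K ] g (suc (toℕ t))                   ≡⟨ sum-init-last {K} (g ∘ toℕ) ⟩
  ∑[ t < K ] g (toℕ (inject₁ t)) + g (toℕ (fromℕ K)) ≡⟨ cong₂ _+_ (sum-cong-≗ {K} (cong g ∘ Fin.toℕ-inject₁))
                                                                   (cong g (Fin.toℕ-fromℕ K)) ⟩
  ∑[ t < K ] g (toℕ t) + g K                         ≡⟨ cong (λ x → ∑[ t < K ] g (toℕ t) + x) gK≡g0 ⟩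
  ∑[ t < K ] g (toℕ t) + g 0                         ≡⟨ ℤ.+-comm _ (g 0) ⟩
  g 0 + ∑[ t < K ] g (toℕ t)                         ∎)
  where open ≡-Reasoning

∑-single : ∀ {K} (f : Vector ℤ K) i → (∀ j → j ≢ i → f j ≡ + 0) → sum f ≡ f i
∑-single {suc K} f i others = begin
  sum f                         ≡⟨ sum-remove {i = i} f ⟩
  f i + sum (removeAt f i)      ≡⟨ cong (λ x → f i + x) (sum-cong-≗ {K} (others _ ∘ Fin.punchInᵢ≢i i)) ⟩
  f i + sum (replicate K (+ 0)) ≡⟨ cong (λ x → f i + x) (sum-replicate-zero K) ⟩
  f i + + 0                     ≡⟨ ℤ.+-identityʳ (f i) ⟩
  f i                           ∎
  where open ≡-Reasoning

toℕ-mod : ∀ a d .⦃ _ : NonZero d ⦄ → toℕ (a mod d) ≡ a % d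
toℕ-mod a d = Fin.toℕ-fromℕ< _

[m%d+n]%d≡[m+n]%d : ∀ m n d .⦃ _ : NonZero d ⦄ → (m % d ℕ.+ n) % d ≡ (m ℕ.+ n) % d
[m%d+n]%d≡[m+n]%d m n d = begin
  (m % d ℕ.+ n) % d          ≡⟨ %-distribˡ-+ (m % d) n d ⟩
  (m % d % d ℕ.+ n % d) % d  ≡⟨ cong (λ x → (x ℕ.+ n % d) % d) (m%n%n≡m%n m d) ⟩
  (m % d ℕ.+ n % d) % d      ≡⟨ %-distribˡ-+ m n d ⟨
  (m ℕ.+ n) % d              ∎
  where open ≡-Reasoning

subZ : (m : ℕ) .⦃ _ : NonZero m ⦄ → Zmod m → Zmod m → Zmod m
subZ m a b = (toℕ a ℕ.+ (m ∸ toℕ b)) mod m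

addZ-subZ : ∀ m .⦃ _ : NonZero m ⦄ (a b : Zmod m) → addZ m (subZ m a b) b ≡ a
addZ-subZ m a b = Fin.toℕ-injective (begin
  toℕ (addZ m (subZ m a b) b)                  ≡⟨ toℕ-mod _ m ⟩
  (toℕ (subZ m a b) ℕ.+ toℕ b) % m             ≡⟨ cong (λ x → (x ℕ.+ toℕ b) % m) (toℕ-mod _ m) ⟩
  ((toℕ a ℕ.+ (m ∸ toℕ b)) % m ℕ.+ toℕ b) % m  ≡⟨ [m%d+n]%d≡[m+n]%d _ (toℕ b) m ⟩
  (toℕ a ℕ.+ (m ∸ toℕ b) ℕ.+ toℕ b) % m        ≡⟨ cong (_% m) (ℕ.+-assoc (toℕ a) _ (toℕ b)) ⟩
  (toℕ a ℕ.+ (m ∸ toℕ b ℕ.+ toℕ b)) % m        ≡⟨ cong ((_% m) ∘ (toℕ a ℕ.+_)) (ℕ.m∸n+n≡m (Fin.toℕ≤n b)) ⟩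
  (toℕ a ℕ.+ m) % m                            ≡⟨ [m+n]%n≡m%n (toℕ a) m ⟩
  toℕ a % m                                    ≡⟨ m<n⇒m%n≡m (Fin.toℕ<n a) ⟩
  toℕ a                                        ∎)
  where open ≡-Reasoning

module Rotation (n m : ℕ) .⦃ _ : NonZero n ⦄ where

  rotate-+ : ∀ k l (c : Config n m) i → rotate n m k (rotate n m l c) i ≡ rotate n m (k ℕ.+ l) c i
  rotate-+ k l c i = cong c (Fin.toℕ-injective (begin
    toℕ ((toℕ ((toℕ i ℕ.+ k) mod n) ℕ.+ l) mod n) ≡⟨ toℕ-mod _ n ⟩
    (toℕ ((toℕ i ℕ.+ k) mod n) ℕ.+ l) % n         ≡⟨ cong (λ x → (x ℕ.+ l) % n) (toℕ-mod _ n) ⟩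
    ((toℕ i ℕ.+ k) % n ℕ.+ l) % n                 ≡⟨ [m%d+n]%d≡[m+n]%d _ l n ⟩
    (toℕ i ℕ.+ k ℕ.+ l) % n                       ≡⟨ cong (_% n) (ℕ.+-assoc (toℕ i) k l) ⟩
    (toℕ i ℕ.+ (k ℕ.+ l)) % n                     ≡⟨ toℕ-mod _ n ⟨
    toℕ ((toℕ i ℕ.+ (k ℕ.+ l)) mod n)             ∎))
    where open ≡-Reasoning

  rotate-n : ∀ (c : Config n m) i → rotate n m n c i ≡ c i
  rotate-n c i = cong c (Fin.toℕ-injective (begin
    toℕ ((toℕ i ℕ.+ n) mod n) ≡⟨ toℕ-mod _ n ⟩
    (toℕ i ℕ.+ n) % n         ≡⟨ [m+n]%n≡m%n (toℕ i) n ⟩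
    toℕ i % n                 ≡⟨ m<n⇒m%n≡m (Fin.toℕ<n i) ⟩
    toℕ i                     ∎))
    where open ≡-Reasoning

  module _ .⦃ _ : NonZero m ⦄ where

    Step : Config n m → Config n m → ℕ → Config n m → Set
    Step u y k s = ∀ i → rotate n m k (applyMove n m u y) i ≡ s i

    preimage : ∀ k → k ≤ n → (s y : Config n m) → ∃[ u ] Step u y k s
    preimage k k≤n s y = u , λ i → begin
      rotate n m k (applyMove n m u y) i     ≡⟨ addZ-subZ m _ _ ⟩
      rotate n m k (rotate n m (n ∸ k) s) i  ≡⟨ rotate-+ k (n ∸ k) s i ⟩
      rotate n m (k ℕ.+ (n ∸ k)) s i         ≡⟨ cong (λ l → rotate n m l s i) (ℕ.m+[n∸m]≡n k≤n) ⟩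
      rotate n m n s i                       ≡⟨ rotate-n s i ⟩
      s i                                    ∎
      where
      open ≡-Reasoning
      u : Config n m
      u i = subZ m (rotate n m (n ∸ k) s i) (y i)

module _ {n m : ℕ} .⦃ _ : NonZero n ⦄ .⦃ _ : NonZero m ⦄ {P : Config n m → Set}
         (P-cong : ∀ {c c′} → (∀ i → c i ≡ c′ i) → P c′ → P c) where

  All-states-cong : ∀ {c c′} → (∀ i → c i ≡ c′ i) →
                    ∀ ys rs → All P (states n m c′ ys rs) → All P (states n m c ys rs)
  All-states-cong c≗c′ []       rs (pc′ ∷ []) = P-cong c≗c′ pc′ ∷ []
  All-states-cong c≗c′ (y ∷ ys) rs (pc′ ∷ ps) =
    P-cong c≗c′ pc′ ∷
    All-states-cong (λ i → cong (λ a → addZ m a (y _)) (c≗c′ _)) ys (λ j → rs (suc j)) ps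

All-states-head : ∀ {n m} .⦃ _ : NonZero n ⦄ .⦃ _ : NonZero m ⦄ {P : Config n m → Set} {c} ys {rs} →
                  All P (states n m c ys rs) → P c
All-states-head []      (pc ∷ _) = pc
All-states-head (_ ∷ _) (pc ∷ _) = pc

module StrideSums (n m : ℕ) .⦃ _ : NonZero n ⦄ .⦃ _ : NonZero m ⦄
                  (q : ℕ) (q∣m : q ℕ.∣ m) (p N : ℕ) (n≡N*p : n ≡ N ℕ.* p) where

  open Congruence q
  open Rotation n m

  ⟦_⟧ : Config n m → ℕ → ℤ
  ⟦ c ⟧ j = + toℕ (c (j mod n))

  %≈ : ∀ x → + (x % m) ≈ + x
  %≈ x = begin
    + (x % m)                       ≈⟨ ∣⇒+≈ (+ (x % m)) (∣n⇒∣m*n (+ (x / m)) (∣ᵤ⇒∣ q∣m)) ⟨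
    + (x % m) + + (x / m) * + m     ≡⟨ cong (λ z → + (x % m) + z) (ℤ.pos-* (x / m) m) ⟨
    + (x % m) + + (x / m ℕ.* m)     ≡⟨ ℤ.pos-+ (x % m) (x / m ℕ.* m) ⟨
    + (x % m ℕ.+ x / m ℕ.* m)       ≡⟨ cong +_ (m≡m%n+[m/n]*n x m) ⟨
    + x                             ∎
    where open import Relation.Binary.Reasoning.Setoid ≈-setoid

  ⟦⟧-cong-% : ∀ c {a b} → a % n ≡ b % n → ⟦ c ⟧ a ≡ ⟦ c ⟧ b
  ⟦⟧-cong-% c {a} {b} a≡b =
    cong (+_ ∘ toℕ ∘ c) (Fin.toℕ-injective (trans (toℕ-mod a n) (trans a≡b (sym (toℕ-mod b n)))))

  ⟦applyMove⟧ : ∀ c y j → ⟦ applyMove n m c y ⟧ j ≈ ⟦ c ⟧ j + ⟦ y ⟧ j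
  ⟦applyMove⟧ c y j = begin
    + toℕ (addZ m a b)        ≡⟨ cong +_ (toℕ-mod _ m) ⟩
    + ((toℕ a ℕ.+ toℕ b) % m) ≈⟨ %≈ _ ⟩
    + (toℕ a ℕ.+ toℕ b)       ≡⟨ ℤ.pos-+ (toℕ a) (toℕ b) ⟩
    + toℕ a + + toℕ b         ∎
    where
    open import Relation.Binary.Reasoning.Setoid ≈-setoid
    a b : Zmod m
    a = c (j mod n)
    b = y (j mod n)

  ⟦rotate⟧ : ∀ k c j → ⟦ rotate n m k c ⟧ j ≡ ⟦ c ⟧ (k ℕ.+ j)
  ⟦rotate⟧ k c j = ⟦⟧-cong-% c (begin
    (toℕ (j mod n) ℕ.+ k) % n ≡⟨ cong (λ x → (x ℕ.+ k) % n) (toℕ-mod j n) ⟩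
    (j % n ℕ.+ k) % n         ≡⟨ [m%d+n]%d≡[m+n]%d j k n ⟩
    (j ℕ.+ k) % n             ≡⟨ cong (_% n) (ℕ.+-comm j k) ⟩
    (k ℕ.+ j) % n             ∎)
    where open ≡-Reasoning

  ∑stride : Config n m → ℕ → ℤ
  ∑stride c r = ∑[ t < N ] ⟦ c ⟧ (r ℕ.+ toℕ t ℕ.* p)

  ∑stride-cong : ∀ {c c′} → (∀ i → c i ≡ c′ i) → ∀ r → ∑stride c r ≡ ∑stride c′ r
  ∑stride-cong c≗c′ r = sum-cong-≗ {N} (λ t → cong (+_ ∘ toℕ) (c≗c′ _))

  ∑stride-rotate : ∀ k c r → ∑stride (rotate n m k c) r ≡ ∑stride c (k ℕ.+ r)
  ∑stride-rotate k c r = sum-cong-≗ {N} λ t →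
    trans (⟦rotate⟧ k c _) (cong ⟦ c ⟧ (sym (ℕ.+-assoc k r (toℕ t ℕ.* p))))

  ∑stride-applyMove : ∀ c y r → ∑stride (applyMove n m c y) r ≈ ∑stride c r + ∑stride y r
  ∑stride-applyMove c y r = begin
    ∑stride (applyMove n m c y) r                     ≈⟨ ∑-cong-≈ {N} (λ t → ⟦applyMove⟧ c y (j t)) ⟩
    ∑[ t < N ] (⟦ c ⟧ (j t) + ⟦ y ⟧ (j t))            ≡⟨ ∑-distrib-+ {N} _ _ ⟩
    ∑stride c r + ∑stride y r                         ∎
    where
    open import Relation.Binary.Reasoning.Setoid ≈-setoid
    j : Fin N → ℕ
    j t = r ℕ.+ toℕ t ℕ.* p

  ∑stride-period : ∀ c → ∑stride c p ≡ ∑stride c 0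
  -- ∑stride c p is the sum shifted by one term, as suc t * p unfolds to p + t * p.
  ∑stride-period c = ∑-shift {N} (λ t → ⟦ c ⟧ (t ℕ.* p)) (⟦⟧-cong-% c (begin
    (N ℕ.* p) % n ≡⟨ cong (_% n) n≡N*p ⟨
    n % n         ≡⟨ n%n≡0 n ⟩
    0             ≡⟨ m*n%n≡0 0 n ⟨
    0 % n         ∎))
    where open ≡-Reasoning

  ∑stride-step : ∀ {u y k s} → Step u y k s →
                 ∀ r → ∑stride s r ≈ ∑stride u (k ℕ.+ r) + ∑stride y (k ℕ.+ r)
  ∑stride-step {u} {y} {k} {s} u↦s r = begin
    ∑stride s r                                  ≡⟨ ∑stride-cong (sym ∘ u↦s) r ⟩
    ∑stride (rotate n m k (applyMove n m u y)) r ≡⟨ ∑stride-rotate k (applyMove n m u y) r ⟩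
    ∑stride (applyMove n m u y) (k ℕ.+ r)        ≈⟨ ∑stride-applyMove u y (k ℕ.+ r) ⟩
    ∑stride u (k ℕ.+ r) + ∑stride y (k ℕ.+ r)    ∎
    where open import Relation.Binary.Reasoning.Setoid ≈-setoid

  Balanced : Config n m → Set
  Balanced c = ∀ r → r ≤ p → ∑stride c r ≈ ∑stride c 0

  Unbalanced : Config n m → Set
  Unbalanced c = ¬ Balanced c

  balanced? : ∀ c → Dec (Balanced c)
  balanced? c = Dec.map′ from-Fin to-Fin (Fin.all? (λ i → ∑stride c (toℕ i) ≈? ∑stride c 0))
    where
    from-Fin : (∀ (i : Fin (suc p)) → ∑stride c (toℕ i) ≈ ∑stride c 0) → Balanced c
    from-Fin balanced r r≤p = subst (λ r → ∑stride c r ≈ ∑stride c 0) (Fin.toℕ-fromℕ< (s≤s r≤p))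
                                    (balanced (Fin.fromℕ< (s≤s r≤p)))
    to-Fin : Balanced c → ∀ (i : Fin (suc p)) → ∑stride c (toℕ i) ≈ ∑stride c 0
    to-Fin balanced i = balanced (toℕ i) (Fin.toℕ≤pred[n] i)

  Unbalanced-cong : ∀ {c c′} → (∀ i → c i ≡ c′ i) → Unbalanced c′ → Unbalanced c
  Unbalanced-cong c≗c′ unbalanced balanced =
    unbalanced λ r r≤p → subst₂ _≈_ (∑stride-cong c≗c′ r) (∑stride-cong c≗c′ 0) (balanced r r≤p)

  allZero⇒balanced : ∀ c → AllZero n m c → Balanced c
  allZero⇒balanced c all-zero r _ =
    ≈-reflexive (sum-cong-≗ {N} λ t → trans (counter≡0 _) (sym (counter≡0 _)))
    where
    counter≡0 : ∀ i → + toℕ (c i) ≡ + toℕ (zeroZ m)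
    counter≡0 i = cong (+_ ∘ toℕ) (all-zero i)

  balanced-predecessors⇒balanced : Prime q → ¬ q ℕ.∣ p → ∀ {s y u₀ u₁} →
    Step u₀ y 0 s → Step u₁ y 1 s → Balanced u₀ → Balanced u₁ → Balanced s
  balanced-predecessors⇒balanced q-prime q∤p {s} {y} {u₀} {u₁} u₀↦s u₁↦s balanced₀ balanced₁ =
    periodic-progression⇒constant (∑stride s) d increment q-prime q∤p (∑stride-period s)
    where
    open import Relation.Binary.Reasoning.Setoid ≈-setoid
    d : ℤ
    d = ∑stride u₀ 0 - ∑stride u₁ 0
    regroup : ∀ a b x → a + x ≡ b + x + (a - b)
    regroup = solve-∀
    increment : ∀ r → r < p → ∑stride s (suc r) ≈ ∑stride s r + d
    increment r r<p = begin
      ∑stride s (suc r)                          ≈⟨ ∑stride-step {u₀} {y} {0} u₀↦s (suc r) ⟩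
      ∑stride u₀ (suc r) + ∑stride y (suc r)     ≈⟨ +-cong (balanced₀ (suc r) r<p) ≈-refl ⟩
      ∑stride u₀ 0 + ∑stride y (suc r)           ≡⟨ regroup (∑stride u₀ 0) (∑stride u₁ 0) (∑stride y (suc r)) ⟩
      ∑stride u₁ 0 + ∑stride y (suc r) + d       ≈⟨ +-cong (+-cong (balanced₁ (suc r) r<p) ≈-refl) ≈-refl ⟨
      ∑stride u₁ (suc r) + ∑stride y (suc r) + d ≈⟨ +-cong (∑stride-step {u₁} {y} {1} u₁↦s r) ≈-refl ⟨
      ∑stride s r + d                            ∎

  module _ (q-prime : Prime q) (q∤p : ¬ q ℕ.∣ p) where

    unbalanced-predecessor : ∀ s → Unbalanced s → ∀ y → ∃₂ λ k u → Step u y k s × Unbalanced u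
    unbalanced-predecessor s unbalanced y
      with preimage 0 z≤n s y | preimage 1 (ℕ.>-nonZero⁻¹ n) s y
    ... | u₀ , u₀↦s | u₁ , u₁↦s with balanced? u₀ | balanced? u₁
    ... | no unbalanced₀ | _              = 0 , u₀ , u₀↦s , unbalanced₀
    ... | yes _          | no unbalanced₁ = 1 , u₁ , u₁↦s , unbalanced₁
    ... | yes balanced₀  | yes balanced₁  = contradiction
      (balanced-predecessors⇒balanced q-prime q∤p {s} {y} {u₀} {u₁} u₀↦s u₁↦s balanced₀ balanced₁)
      unbalanced

    adversary : ∀ s → Unbalanced s → ∀ ys → ∃₂ λ c rs → All Unbalanced (states n m c ys rs)
    adversary s unbalanced []       = s , (λ _ → 0) , unbalanced ∷ []
    adversary s unbalanced (y ∷ ys) with adversary s unbalanced ys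
    ... | c , rs , unbalanced-states with unbalanced-predecessor c (All-states-head ys unbalanced-states) y
    ... | k , u , u↦c , unbalanced-u =
      u , rs′ , unbalanced-u ∷ All-states-cong Unbalanced-cong u↦c ys rs unbalanced-states
      where
      rs′ : ℕ → ℕ
      rs′ zero    = k
      rs′ (suc j) = rs j

    unbalanced⇒¬canWin : ∀ s → Unbalanced s → ¬ CanWin n m
    unbalanced⇒¬canWin s unbalanced (ys , wins) with adversary s unbalanced ys
    ... | c , rs , unbalanced-states =
      All¬⇒¬Any (All.map (λ {c′} u → u ∘ allZero⇒balanced c′) unbalanced-states) (wins c rs)

  indicator : ℕ → Zmod m
  indicator zero    = 1 mod m
  indicator (suc _) = 0 mod m

  δ₀ : Config n m
  δ₀ i = indicator (toℕ i)

  ⟦δ₀⟧ : ∀ j → j < n → ⟦ δ₀ ⟧ j ≡ + toℕ (indicator j)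
  ⟦δ₀⟧ j j<n = cong (+_ ∘ toℕ ∘ indicator) (trans (toℕ-mod j n) (m<n⇒m%n≡m j<n))

  ⟦δ₀⟧-≢0 : ∀ j → j ≢ 0 → j < n → ⟦ δ₀ ⟧ j ≡ + 0
  ⟦δ₀⟧-≢0 zero    j≢0 _   = contradiction refl j≢0
  ⟦δ₀⟧-≢0 (suc j) _   j<n = trans (⟦δ₀⟧ (suc j) j<n) (cong +_ (trans (toℕ-mod 0 m) (m*n%n≡0 0 m)))

  index<n : ∀ r (t : Fin N) → r < p → r ℕ.+ toℕ t ℕ.* p < n
  index<n r t r<p = ℕ.<-≤-trans (ℕ.+-monoˡ-< (toℕ t ℕ.* p) r<p)
                                (subst (suc (toℕ t) ℕ.* p ≤_) (sym n≡N*p) (ℕ.*-monoˡ-≤ p (Fin.toℕ<n t)))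

  module _ (q-prime : Prime q) (1<p : 1 < p) where

    ⟦δ₀⟧-0 : ⟦ δ₀ ⟧ 0 ≡ + 1
    ⟦δ₀⟧-0 = trans (⟦δ₀⟧ 0 (ℕ.>-nonZero⁻¹ n)) (cong +_ (trans (toℕ-mod 1 m) (m<n⇒m%n≡m 1<m)))
      where
      1<m : 1 < m
      1<m = ℕ.<-≤-trans (prime⇒1< q-prime) (ℕ.∣⇒≤ q∣m)

    ∑stride-δ₀-1 : ∑stride δ₀ 1 ≡ + 0
    ∑stride-δ₀-1 =
      trans (sum-cong-≗ {N} (λ t → ⟦δ₀⟧-≢0 _ (λ ()) (index<n 1 t 1<p))) (sum-replicate-zero N)

    ∑stride-δ₀-0 : ∑stride δ₀ 0 ≡ + 1
    ∑stride-δ₀-0 = begin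
      ∑stride δ₀ 0            ≡⟨ ∑-single {N} _ t₀ others ⟩
      ⟦ δ₀ ⟧ (toℕ t₀ ℕ.* p)   ≡⟨ cong (λ t → ⟦ δ₀ ⟧ (t ℕ.* p)) (Fin.toℕ-fromℕ< 0<N) ⟩
      ⟦ δ₀ ⟧ 0                ≡⟨ ⟦δ₀⟧-0 ⟩
      + 1                     ∎
      where
      open ≡-Reasoning
      0<N : 0 < N
      0<N = ℕ.n≢0⇒n>0 λ { refl → ℕ.≢-nonZero⁻¹ n n≡N*p }
      t₀ : Fin N
      t₀ = Fin.fromℕ< 0<N
      others : ∀ t → t ≢ t₀ → ⟦ δ₀ ⟧ (toℕ t ℕ.* p) ≡ + 0
      others t t≢t₀ = ⟦δ₀⟧-≢0 _ tp≢0 (index<n 0 t (ℕ.<-trans z<s 1<p))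
        where
        tp≢0 : toℕ t ℕ.* p ≢ 0
        tp≢0 tp≡0 with ℕ.m*n≡0⇒m≡0∨n≡0 (toℕ t) tp≡0
        ... | inj₁ t≡0  = t≢t₀ (Fin.toℕ-injective (trans t≡0 (sym (Fin.toℕ-fromℕ< 0<N))))
        ... | inj₂ refl = contradiction 1<p λ ()

    δ₀-unbalanced : Unbalanced δ₀
    δ₀-unbalanced balanced = prime⇒≢1 q-prime (ℕ.∣1⇒≡1 (∣⇒∣ᵤ (+≈⇒∣ (+ 0) {+ 1} 1≈0)))
      where
      1≈0 : + 1 ≈ + 0
      1≈0 = subst₂ _≈_ ∑stride-δ₀-0 ∑stride-δ₀-1 (≈-sym (balanced 1 (ℕ.<⇒≤ 1<p)))

record Obstruction (n m : ℕ) : Set where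
  field
    p N q   : ℕ
    n≡N*p   : n ≡ N ℕ.* p
    1<p     : 1 < p
    q-prime : Prime q
    q∣m     : q ℕ.∣ m
    q∤p     : ¬ q ℕ.∣ p

obstruction⇒¬canWin : ∀ {n m} .⦃ _ : NonZero n ⦄ .⦃ _ : NonZero m ⦄ →
                      Obstruction n m → ¬ CanWin n m
obstruction⇒¬canWin {n} {m} obstruction =
  unbalanced⇒¬canWin q-prime q∤p δ₀ (δ₀-unbalanced q-prime 1<p)
  where
  open Obstruction obstruction
  open StrideSums n m q q∣m p N n≡N*p

∃-prime-divisor : ∀ {m} → 1 < m → ∃[ r ] Prime r × r ℕ.∣ m
∃-prime-divisor {m} 1<m with factorise m ⦃ ℕ.>-nonZero (ℕ.<-trans z<s 1<m) ⦄
... | record { factors = [] ; isFactorisation = m≡1 } = contradiction m≡1 (ℕ.>⇒≢ 1<m)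
... | record { factors = r ∷ rs ; isFactorisation = m≡r*rs ; factorsPrime = r-prime ∷ _ } =
  r , r-prime , subst (r ℕ.∣_) (sym m≡r*rs) (ℕ.m∣m*n (product rs))

∣^⇒∣ : ∀ {r q} → Prime r → ∀ a → r ℕ.∣ q ^ a → r ℕ.∣ q
∣^⇒∣ r-prime zero    r∣1 = contradiction (ℕ.∣1⇒≡1 r∣1) (prime⇒≢1 r-prime)
∣^⇒∣ {q = q} r-prime (suc a) r∣q^[1+a] with euclidsLemma q (q ^ a) r-prime r∣q^[1+a]
... | inj₁ r∣q   = r∣q
... | inj₂ r∣q^a = ∣^⇒∣ r-prime a r∣q^a

split-power : ∀ {q} → 1 < q → ∀ n .⦃ _ : NonZero n ⦄ → ∃₂ λ a n′ → n ≡ q ^ a ℕ.* n′ × ¬ q ℕ.∣ n′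
split-power {q} 1<q n = go n (<-wellFounded n)
  where
  go : ∀ n → Acc _<_ n → .⦃ _ : NonZero n ⦄ → ∃₂ λ a n′ → n ≡ q ^ a ℕ.* n′ × ¬ q ℕ.∣ n′
  go n (acc rec) with q ℕ.∣? n
  ... | no q∤n = 0 , n , sym (ℕ.+-identityʳ n) , q∤n
  ... | yes (ℕ.divides k refl) with go k (rec (ℕ.m<m*n k q 1<q)) ⦃ k≢0 ⦄
    where instance k≢0 : NonZero k
                   k≢0 = ℕ.m*n≢0⇒m≢0 k
  ... | a , n′ , refl , q∤n′ =
    suc a , n′ , trans (ℕ.*-comm (q ^ a ℕ.* n′) q) (sym (ℕ.*-assoc q (q ^ a) n′)) , q∤n′

PrimePowers : ℕ → ℕ → Set
PrimePowers n m =
  Σ ℕ (λ p → Σ ℕ (λ a → Σ ℕ (λ b → Prime p × a ≥ 1 × b ≥ 1 × n ≡ p ^ a × m ≡ p ^ b)))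

classify : ∀ n m .⦃ _ : NonZero n ⦄ .⦃ _ : NonZero m ⦄ →
           (n ≡ 1 ⊎ m ≡ 1 ⊎ PrimePowers n m) ⊎ Obstruction n m
classify 1      _ = inj₁ (inj₁ refl)
classify (2+ _) 1 = inj₁ (inj₂ (inj₁ refl))
classify n@(2+ _) m@(2+ _) with ∃-prime-divisor {m} (s≤s (s≤s z≤n))
... | q , q-prime , q∣m with split-power (prime⇒1< q-prime) n
...   | _ , 0 , _ , q∤0 = contradiction (q ℕ.∣0) q∤0
...   | a , n′@(2+ _) , n≡q^a*n′ , q∤n′ = inj₂ (record
        { p = n′ ; N = q ^ a ; q = q ; n≡N*p = n≡q^a*n′ ; 1<p = s≤s (s≤s z≤n)
        ; q-prime = q-prime ; q∣m = q∣m ; q∤p = q∤n′ })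
...   | zero , 1 , () , _
...   | a@(suc _) , 1 , n≡q^a*1 , _ with split-power (prime⇒1< q-prime) m
...     | _ , 0 , _ , q∤0 = contradiction (q ℕ.∣0) q∤0
...     | zero , 1 , () , _
...     | b@(suc _) , 1 , m≡q^b*1 , _ = inj₁ (inj₂ (inj₂ (q , a , b , q-prime , s≤s z≤n , s≤s z≤n ,
          trans n≡q^a*1 (ℕ.*-identityʳ _) , trans m≡q^b*1 (ℕ.*-identityʳ _))))
...     | b , m′@(2+ _) , m≡q^b*m′ , q∤m′ with ∃-prime-divisor {m′} (s≤s (s≤s z≤n))
...       | r , r-prime , r∣m′ = inj₂ (record
          { p = n ; N = 1 ; q = r ; n≡N*p = sym (ℕ.*-identityˡ n) ; 1<p = s≤s (s≤s z≤n)
          ; q-prime = r-prime ; q∣m = ℕ.∣-trans r∣m′ (subst (m′ ℕ.∣_) (sym m≡q^b*m′) (ℕ.n∣m*n (q ^ b)))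
          ; q∤p = r∤n })
  where
  r∤n : ¬ r ℕ.∣ n
  r∤n r∣n
    with prime⇒irreducible q-prime (∣^⇒∣ r-prime a (subst (r ℕ.∣_) (trans n≡q^a*1 (ℕ.*-identityʳ _)) r∣n))
  ... | inj₁ r≡1 = prime⇒≢1 r-prime r≡1
  ... | inj₂ refl = q∤m′ r∣m′

corollary3p3 : (n m : ℕ) .⦃ _ : NonZero n ⦄ .⦃ _ : NonZero m ⦄ →
    CanWin n m →
    n ≡ 1 ⊎ m ≡ 1 ⊎
      Σ ℕ (λ p → Σ ℕ (λ a → Σ ℕ (λ b →
        Prime p × a ≥ 1 × b ≥ 1 × n ≡ p ^ a × m ≡ p ^ b)))
corollary3p3 n m win with classify n m
... | inj₁ conclusion  = conclusion
... | inj₂ obstruction = contradiction win (obstruction⇒¬canWin obstruction)
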